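{- Let $q$ be a prime power, let $k\in\mathbb N$ and let $x$ be an integer with $0\le x\le q+1$. Let $P\subseteq\mathbb F_q^2$ with $|P|=k(q+1)+x+1$. Then \[ T(P)\ \ge\ \frac{1}{3}\left(\binom{k}{2}(q+1)+k\cdot x\right)\cdot |P|. \]
   Context: $\mathbb F_q$ is the finite field with $q$ elements. For $P\subseteq\mathbb F_q^2$, $T(P)$ denotes the number of collinear triples in $P$, i.e. the number of $3$-element subsets $S\subseteq P$ whose three points lie on a common line of $\mathbb F_q^2$. -}

module Defs where

open import Level using (0ℓ)
open import Data.Nat using (ℕ; zero; suc; _^_; _≥_)
open import Data.Nat.Primality using (Prime)
open import Data.Fin using (Fin)
open import Data.Fin.Properties using (any?) renaming (_≟_ to _≟F_)
open import Data.Product using (_×_; _,_; ∃; ∃-syntax; Σ)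
open import Data.List using (List; []; _∷_; map; _++_; length; filter)
open import Relation.Binary.PropositionalEquality using (_≡_)
open import Relation.Nullary using (¬_; Dec; yes; no)
open import Relation.Nullary.Decidable using (_×-dec_; ¬?)
open import Algebra.Structures using (IsCommutativeRing)

IsPrimePower : ℕ → Set
IsPrimePower q = ∃[ p ] ∃[ e ] (Prime p × e ≥ 1 × q ≡ p ^ e)

-- A field structure on the q-element set Fin q (so its carrier has exactly q
-- elements); this is the finite field F_q (unique up to isomorphism).
record FieldOn (q : ℕ) : Set where
  field
    _+_ _*_ : Fin q → Fin q → Fin q
    -_      : Fin q → Fin q
    0# 1#   : Fin q
    isCommutativeRing : IsCommutativeRing _≡_ _+_ _*_ -_ 0# 1#
    0≢1     : ¬ (0# ≡ 1#)
    inverse : ∀ a → ¬ (a ≡ 0#) → ∃[ b ] (a * b ≡ 1#)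

module _ {q : ℕ} (F : FieldOn q) where
  open FieldOn F

  Point : Set
  Point = Fin q × Fin q

  OnLine : Fin q → Fin q → Fin q → Point → Set
  OnLine a b c (x , y) = (a * x) + (b * y) ≡ c

  Collinear : Point → Point → Point → Set
  Collinear u v w = ∃[ a ] ∃[ b ] ∃[ c ]
    (¬ (a ≡ 0# × b ≡ 0#) × OnLine a b c u × OnLine a b c v × OnLine a b c w)

  onLine? : ∀ a b c p → Dec (OnLine a b c p)
  onLine? a b c (x , y) = ((a * x) + (b * y)) ≟F c

  collinear? : ∀ u v w → Dec (Collinear u v w)
  collinear? u v w = any? λ a → any? λ b → any? λ c →
    ¬? ((a ≟F 0#) ×-dec (b ≟F 0#)) ×-dec
    (onLine? a b c u ×-dec (onLine? a b c v ×-dec onLine? a b c w))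

pairsWith : {A : Set} → A → List A → List (A × A × A)
pairsWith a [] = []
pairsWith a (b ∷ bs) = map (λ c → a , b , c) bs ++ pairsWith a bs

triples : {A : Set} → List A → List (A × A × A)
triples [] = []
triples (a ∷ as) = pairsWith a as ++ triples as

-- T(P): number of collinear triples in P, where P is given as a
-- duplicate-free list of points (so position-triples = 3-element subsets)
T : {q : ℕ} (F : FieldOn q) → List (Point F) → ℕ
T F P = length (filter (λ { (u , v , w) → collinear? F u v w }) (triples P))

-- Fix a point a of P. The remaining N = k(q+1)+x points are distributed among the
-- q+1 lines through a, and any two of them on a common line through a form a
-- collinear triple with a. Since n ↦ C(n,2) is convex, spreading N points over
-- q+1 classes produces at least (q+1)·C(k,2) + k·x such pairs. Summing over the
-- |P| choices of a counts every collinear triple exactly three times.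
module Submission where

open import Defs
open import Level using (0ℓ)
open import Algebra.Bundles using (CommutativeRing)
open import Algebra.Structures using (IsCommutativeRing)
import Algebra.Properties.Ring as RingProperties
import Algebra.Properties.CommutativeSemigroup as CommutativeSemigroupProperties
open import Data.Bool.Base using (true; false; if_then_else_)
open import Data.Nat using (ℕ; zero; suc; _+_; _*_; _≤_; z≤n)
open import Data.Nat.Properties
  using ( ≤-refl; ≤-reflexive; ≤-trans; ≤-antisym; +-mono-≤; +-monoˡ-≤; +-monoʳ-≤; +-cancelʳ-≤
        ; m≤m+n; +-comm; +-identityʳ; *-identityˡ; *-identityʳ; *-comm; *-distribˡ-+
        ; *-zeroʳ; suc-injective; module ≤-Reasoning; +-commutativeSemigroup )
open import Data.Nat.Combinatorics using (_C_; nC1≡n; nCk+nC[k+1]≡[n+1]C[k+1])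
open import Data.Nat.ListAction using (sum)
import Data.Nat.ListAction.Properties as ListActionProperties
open import Data.Nat.Solver using (module +-*-Solver)
open import Data.Fin using (Fin; zero; suc)
open import Data.Fin.Properties using (_≟_)
open import Data.List using (List; []; _∷_; map; _++_; length; filter; allFin; tabulate)
open import Data.List.Properties using (length-map; map-++; map-∘; length-tabulate)
open import Data.List.Relation.Unary.Unique.Propositional using (Unique)
open import Data.Product using (_×_; _,_; proj₁; proj₂; map₂; uncurry)
open import Function using (_∘_)
open import Relation.Binary.PropositionalEquality
open import Relation.Nullary using (¬_; Dec; yes; no; does; contradiction)

open +-*-Solver using (solve; _:=_; _:+_; _:*_; con)
open CommutativeSemigroupProperties +-commutativeSemigroup using (interchange)

private variable
  A B : Set

∑ : (A → ℕ) → List A → ℕ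
∑ f xs = sum (map f xs)

∑-cong : ∀ {f g : A → ℕ} → (∀ x → f x ≡ g x) → ∀ xs → ∑ f xs ≡ ∑ g xs
∑-cong f≡g []       = refl
∑-cong f≡g (x ∷ xs) = cong₂ _+_ (f≡g x) (∑-cong f≡g xs)

∑-mono : ∀ {f g : A → ℕ} → (∀ x → f x ≤ g x) → ∀ xs → ∑ f xs ≤ ∑ g xs
∑-mono f≤g []       = z≤n
∑-mono f≤g (x ∷ xs) = +-mono-≤ (f≤g x) (∑-mono f≤g xs)

∑-+ : ∀ (f g : A → ℕ) xs → ∑ (λ x → f x + g x) xs ≡ ∑ f xs + ∑ g xs
∑-+ f g []       = refl
∑-+ f g (x ∷ xs) = trans (cong (f x + g x +_) (∑-+ f g xs)) (interchange (f x) (g x) _ _)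

∑-*ˡ : ∀ k (f : A → ℕ) xs → ∑ (λ x → k * f x) xs ≡ k * ∑ f xs
∑-*ˡ k f []       = sym (*-zeroʳ k)
∑-*ˡ k f (x ∷ xs) = trans (cong (k * f x +_) (∑-*ˡ k f xs)) (sym (*-distribˡ-+ k (f x) _))

∑-zero : ∀ (xs : List A) → ∑ (λ _ → 0) xs ≡ 0
∑-zero []       = refl
∑-zero (x ∷ xs) = ∑-zero xs

∑-const : ∀ c (xs : List A) → ∑ (λ _ → c) xs ≡ length xs * c
∑-const c []       = refl
∑-const c (x ∷ xs) = cong (c +_) (∑-const c xs)

∑-map : ∀ (f : B → ℕ) (g : A → B) xs → ∑ f (map g xs) ≡ ∑ (f ∘ g) xs
∑-map f g xs = cong sum (sym (map-∘ xs))

∑-++ : ∀ (f : A → ℕ) xs ys → ∑ f (xs ++ ys) ≡ ∑ f xs + ∑ f ys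
∑-++ f xs ys = trans (cong sum (map-++ f xs ys)) (ListActionProperties.sum-++ (map f xs) (map f ys))

∑-tabulate : ∀ {n} (f : A → ℕ) (g : Fin n → A) → ∑ f (tabulate g) ≡ ∑ (f ∘ g) (allFin n)
∑-tabulate {n = zero}  f g = refl
∑-tabulate {n = suc n} f g =
  cong (f (g zero) +_) (trans (∑-tabulate f (g ∘ suc)) (sym (∑-tabulate (f ∘ g) suc)))

∑-allFin-suc : ∀ {n} (f : Fin (suc n) → ℕ) → ∑ f (allFin (suc n)) ≡ f zero + ∑ (f ∘ suc) (allFin n)
∑-allFin-suc f = cong (f zero +_) (∑-tabulate f suc)

∑-allFin-const : ∀ n c → ∑ (λ _ → c) (allFin n) ≡ n * c
∑-allFin-const n c = trans (∑-const c (allFin n)) (cong (_* c) (length-tabulate {n = n} (λ i → i)))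

𝟙 : {P : Set} → Dec P → ℕ
𝟙 p = if does p then 1 else 0

𝟙-mono : {P Q : Set} → (P → Q) → (p : Dec P) (q : Dec Q) → 𝟙 p ≤ 𝟙 q
𝟙-mono P⇒Q (yes _)  (yes _) = ≤-refl
𝟙-mono P⇒Q (yes p)  (no ¬q) = contradiction (P⇒Q p) ¬q
𝟙-mono P⇒Q (no _)   _       = z≤n

𝟙-cong : {P Q : Set} → (P → Q) → (Q → P) → (p : Dec P) (q : Dec Q) → 𝟙 p ≡ 𝟙 q
𝟙-cong P⇒Q Q⇒P p q = ≤-antisym (𝟙-mono P⇒Q p q) (𝟙-mono Q⇒P q p)

length-filter : ∀ {P : A → Set} (P? : ∀ x → Dec (P x)) xs → length (filter P? xs) ≡ ∑ (𝟙 ∘ P?) xs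
length-filter P? []       = refl
length-filter P? (x ∷ xs) with does (P? x)
... | true  = cong suc (length-filter P? xs)
... | false = length-filter P? xs

∑-allFin-𝟙≟ : ∀ {n} (f : Fin n → ℕ) a → ∑ (λ d → 𝟙 (d ≟ a) * f d) (allFin n) ≡ f a
∑-allFin-𝟙≟ {suc n} f zero    =
  trans (∑-allFin-suc (λ d → 𝟙 (d ≟ zero) * f d))
        (trans (cong₂ _+_ (*-identityˡ (f zero)) (∑-zero (allFin n))) (+-identityʳ _))
∑-allFin-𝟙≟ {suc n} f (suc a) =
  trans (∑-allFin-suc (λ d → 𝟙 (d ≟ suc a) * f d)) (∑-allFin-𝟙≟ (f ∘ suc) a)

∑-pairs : (A → A → ℕ) → List A → ℕ
∑-pairs w []       = 0
∑-pairs w (x ∷ xs) = ∑ (w x) xs + ∑-pairs w xs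

∑-triples : (A → A → A → ℕ) → List A → ℕ
∑-triples w []       = 0
∑-triples w (x ∷ xs) = ∑-pairs (w x) xs + ∑-triples w xs

∑-pairs-mono : ∀ {v w : A → A → ℕ} → (∀ x y → v x y ≤ w x y) → ∀ xs → ∑-pairs v xs ≤ ∑-pairs w xs
∑-pairs-mono v≤w []       = z≤n
∑-pairs-mono v≤w (x ∷ xs) = +-mono-≤ (∑-mono (v≤w x) xs) (∑-pairs-mono v≤w xs)

∑-pairs-map : ∀ (w : B → B → ℕ) (f : A → B) xs →
              ∑-pairs w (map f xs) ≡ ∑-pairs (λ x y → w (f x) (f y)) xs
∑-pairs-map w f []       = refl
∑-pairs-map w f (x ∷ xs) = cong₂ _+_ (∑-map (w (f x)) f xs) (∑-pairs-map w f xs)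

∑-pairsWith : ∀ (h : A × A × A → ℕ) a bs → ∑ h (pairsWith a bs) ≡ ∑-pairs (λ b c → h (a , b , c)) bs
∑-pairsWith h a []       = refl
∑-pairsWith h a (b ∷ bs) =
  trans (∑-++ h (map (λ c → a , b , c) bs) (pairsWith a bs))
        (cong₂ _+_ (∑-map h (λ c → a , b , c) bs) (∑-pairsWith h a bs))

∑-triples-triples : ∀ (h : A × A × A → ℕ) xs → ∑ h (triples xs) ≡ ∑-triples (λ a b c → h (a , b , c)) xs
∑-triples-triples h []       = refl
∑-triples-triples h (a ∷ as) =
  trans (∑-++ h (pairsWith a as) (triples as)) (cong₂ _+_ (∑-pairsWith h a as) (∑-triples-triples h as))

selections : List A → List (A × List A)
selections []       = []
selections (x ∷ xs) = (x , xs) ∷ map (map₂ (x ∷_)) (selections xs)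

∑-select : (A → List A → ℕ) → List A → ℕ
∑-select F xs = ∑ (uncurry F) (selections xs)

∑-select-∷ : ∀ (F : A → List A → ℕ) x xs → ∑-select F (x ∷ xs) ≡ F x xs + ∑-select (λ a r → F a (x ∷ r)) xs
∑-select-∷ F x xs = cong (F x xs +_) (∑-map (uncurry F) (map₂ (x ∷_)) (selections xs))

∑-select-proj₁ : ∀ (g : A → ℕ) xs → ∑-select (λ a _ → g a) xs ≡ ∑ g xs
∑-select-proj₁ g []       = refl
∑-select-proj₁ g (x ∷ xs) = trans (∑-select-∷ (λ a _ → g a) x xs) (cong (g x +_) (∑-select-proj₁ g xs))

∑-select-≥ : ∀ (F : A → List A → ℕ) c xs → (∀ a r → suc (length r) ≡ length xs → c ≤ F a r) →
             length xs * c ≤ ∑-select F xs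
∑-select-≥ F c []       _ = z≤n
∑-select-≥ F c (x ∷ xs) c≤F = ≤-trans
  (+-mono-≤ (c≤F x xs refl) (∑-select-≥ (λ a r → F a (x ∷ r)) c xs (λ a r eq → c≤F a (x ∷ r) (cong suc eq))))
  (≤-reflexive (sym (∑-select-∷ F x xs)))

∑-select-∑ : ∀ (Q : A → A → ℕ) → (∀ a b → Q a b ≡ Q b a) → ∀ xs →
             ∑-select (λ a r → ∑ (Q a) r) xs ≡ 2 * ∑-pairs Q xs
∑-select-∑ Q Q-sym []       = refl
∑-select-∑ Q Q-sym (y ∷ ys) = begin
  ∑-select (λ a r → ∑ (Q a) r) (y ∷ ys)
    ≡⟨ ∑-select-∷ (λ a r → ∑ (Q a) r) y ys ⟩
  ∑ (Q y) ys + ∑-select (λ a r → Q a y + ∑ (Q a) r) ys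
    ≡⟨ cong (∑ (Q y) ys +_) (∑-+ (λ p → Q (proj₁ p) y) (uncurry λ a r → ∑ (Q a) r) (selections ys)) ⟩
  ∑ (Q y) ys + (∑-select (λ a _ → Q a y) ys + ∑-select (λ a r → ∑ (Q a) r) ys)
    ≡⟨ cong₂ (λ m n → ∑ (Q y) ys + (m + n))
         (trans (∑-select-proj₁ (λ a → Q a y) ys) (∑-cong (λ a → Q-sym a y) ys)) (∑-select-∑ Q Q-sym ys) ⟩
  ∑ (Q y) ys + (∑ (Q y) ys + 2 * ∑-pairs Q ys)
    ≡⟨ solve 2 (λ m n → m :+ (m :+ con 2 :* n) := con 2 :* (m :+ n)) refl (∑ (Q y) ys) (∑-pairs Q ys) ⟩
  2 * (∑ (Q y) ys + ∑-pairs Q ys) ∎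
  where open ≡-Reasoning

∑-select-∑-pairs : ∀ (w : A → A → A → ℕ) →
                   (∀ a b c → w a b c ≡ w b a c) → (∀ a b c → w a b c ≡ w a c b) → ∀ xs →
                   ∑-select (λ a r → ∑-pairs (w a) r) xs ≡ 3 * ∑-triples w xs
∑-select-∑-pairs w w-swap₁₂ w-swap₂₃ []       = refl
∑-select-∑-pairs w w-swap₁₂ w-swap₂₃ (x ∷ xs) = begin
  ∑-select (λ a r → ∑-pairs (w a) r) (x ∷ xs)
    ≡⟨ ∑-select-∷ (λ a r → ∑-pairs (w a) r) x xs ⟩
  ∑-pairs (w x) xs + ∑-select (λ a r → ∑ (w a x) r + ∑-pairs (w a) r) xs
    ≡⟨ cong (∑-pairs (w x) xs +_)
         (∑-+ (uncurry λ a r → ∑ (w a x) r) (uncurry λ a r → ∑-pairs (w a) r) (selections xs)) ⟩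
  ∑-pairs (w x) xs + (∑-select (λ a r → ∑ (w a x) r) xs + ∑-select (λ a r → ∑-pairs (w a) r) xs)
    ≡⟨ cong₂ (λ m n → ∑-pairs (w x) xs + (m + n))
         (trans (∑-cong (λ p → ∑-cong (w-swap₁₂ (proj₁ p) x) (proj₂ p)) (selections xs))
                (∑-select-∑ (w x) (w-swap₂₃ x) xs))
         (∑-select-∑-pairs w w-swap₁₂ w-swap₂₃ xs) ⟩
  ∑-pairs (w x) xs + (2 * ∑-pairs (w x) xs + 3 * ∑-triples w xs)
    ≡⟨ solve 2 (λ m n → m :+ (con 2 :* m :+ con 3 :* n) := con 3 :* (m :+ n)) refl
         (∑-pairs (w x) xs) (∑-triples w xs) ⟩
  3 * (∑-pairs (w x) xs + ∑-triples w xs) ∎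
  where open ≡-Reasoning

suc-C2 : ∀ n → suc n C 2 ≡ n + n C 2
suc-C2 n = trans (sym (nCk+nC[k+1]≡[n+1]C[k+1] n 1)) (cong (_+ n C 2) (nC1≡n n))

𝟙+C2 : {P : Set} (p : Dec P) (n : ℕ) → (𝟙 p + n) C 2 ≡ n C 2 + 𝟙 p * n
𝟙+C2 (yes _) n = trans (suc-C2 n) (trans (+-comm n (n C 2)) (cong (n C 2 +_) (sym (*-identityˡ n))))
𝟙+C2 (no _)  n = sym (+-identityʳ (n C 2))

nC2≤n*n : ∀ n → n C 2 ≤ n * n
nC2≤n*n zero    = z≤n
nC2≤n*n (suc n) = begin
  suc n C 2         ≡⟨ suc-C2 n ⟩
  n + n C 2         ≤⟨ +-monoʳ-≤ n (nC2≤n*n n) ⟩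
  n + n * n         ≤⟨ m≤m+n (n + n * n) (suc n) ⟩
  n + n * n + suc n ≡⟨ solve 1 (λ n → n :+ n :* n :+ (con 1 :+ n) := (con 1 :+ n) :* (con 1 :+ n)) refl n ⟩
  suc n * suc n     ∎
  where open ≤-Reasoning

-- Convexity of n ↦ C(n,2): its graph lies above the chord through k and k+1.
kC2+k*m≤mC2+k*k : ∀ k m → k C 2 + k * m ≤ m C 2 + k * k
kC2+k*m≤mC2+k*k k       zero    = ≤-trans (≤-reflexive (trans (cong (k C 2 +_) (*-zeroʳ k)) (+-identityʳ _)))
                                           (nC2≤n*n k)
kC2+k*m≤mC2+k*k zero    (suc m) = z≤n
kC2+k*m≤mC2+k*k (suc k) (suc m) = begin
  suc k C 2 + suc k * suc m               ≡⟨ cong (_+ suc k * suc m) (suc-C2 k) ⟩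
  k + k C 2 + suc k * suc m               ≡⟨ solve 4 (λ k m c d → k :+ c :+ (con 1 :+ k) :* (con 1 :+ m)
                                                := (c :+ k :* m) :+ (m :+ con 2 :* k :+ con 1)) refl k m (k C 2) (m C 2) ⟩
  (k C 2 + k * m) + (m + 2 * k + 1)       ≤⟨ +-monoˡ-≤ (m + 2 * k + 1) (kC2+k*m≤mC2+k*k k m) ⟩
  (m C 2 + k * k) + (m + 2 * k + 1)       ≡⟨ solve 4 (λ k m c d → (d :+ k :* k) :+ (m :+ con 2 :* k :+ con 1)
                                                := m :+ d :+ (con 1 :+ k) :* (con 1 :+ k)) refl k m (k C 2) (m C 2) ⟩
  m + m C 2 + suc k * suc k               ≡⟨ cong (_+ suc k * suc k) (sym (suc-C2 m)) ⟩
  suc m C 2 + suc k * suc k               ∎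
  where open ≤-Reasoning

module _ {s : ℕ} where

  count : Fin s → List (Fin s) → ℕ
  count d = ∑ (λ b → 𝟙 (d ≟ b))

  ∑-count : ∀ L → ∑ (λ d → count d L) (allFin s) ≡ length L
  ∑-count []      = ∑-zero (allFin s)
  ∑-count (a ∷ L) = begin
    ∑ (λ d → 𝟙 (d ≟ a) + count d L) (allFin s)
      ≡⟨ ∑-+ (λ d → 𝟙 (d ≟ a)) (λ d → count d L) (allFin s) ⟩
    ∑ (λ d → 𝟙 (d ≟ a)) (allFin s) + ∑ (λ d → count d L) (allFin s)
      ≡⟨ cong₂ _+_ (trans (∑-cong (λ d → sym (*-identityʳ (𝟙 (d ≟ a)))) (allFin s)) (∑-allFin-𝟙≟ (λ _ → 1) a))
                   (∑-count L) ⟩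
    suc (length L) ∎
    where open ≡-Reasoning

  ∑-count-C2 : ∀ L → ∑ (λ d → count d L C 2) (allFin s) ≡ ∑-pairs (λ b c → 𝟙 (b ≟ c)) L
  ∑-count-C2 []      = ∑-zero (allFin s)
  ∑-count-C2 (a ∷ L) = begin
    ∑ (λ d → (𝟙 (d ≟ a) + count d L) C 2) (allFin s)
      ≡⟨ ∑-cong (λ d → 𝟙+C2 (d ≟ a) (count d L)) (allFin s) ⟩
    ∑ (λ d → count d L C 2 + 𝟙 (d ≟ a) * count d L) (allFin s)
      ≡⟨ ∑-+ (λ d → count d L C 2) (λ d → 𝟙 (d ≟ a) * count d L) (allFin s) ⟩
    ∑ (λ d → count d L C 2) (allFin s) + ∑ (λ d → 𝟙 (d ≟ a) * count d L) (allFin s)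
      ≡⟨ cong₂ _+_ (∑-count-C2 L) (∑-allFin-𝟙≟ (λ d → count d L) a) ⟩
    ∑-pairs (λ b c → 𝟙 (b ≟ c)) L + count a L
      ≡⟨ +-comm (∑-pairs (λ b c → 𝟙 (b ≟ c)) L) (count a L) ⟩
    count a L + ∑-pairs (λ b c → 𝟙 (b ≟ c)) L ∎
    where open ≡-Reasoning

  -- The term s·k² is added to both sides so that no subtraction occurs.
  equalPairs-≥ : ∀ k x (L : List (Fin s)) → length L ≡ k * s + x →
                 (k C 2) * s + k * x ≤ ∑-pairs (λ b c → 𝟙 (b ≟ c)) L
  equalPairs-≥ k x L len = +-cancelʳ-≤ (s * (k * k)) _ _ (begin
    ((k C 2) * s + k * x) + s * (k * k)
      ≡⟨ solve 4 (λ s k x c → (c :* s :+ k :* x) :+ s :* (k :* k) := s :* c :+ k :* (k :* s :+ x)) refl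
           s k x (k C 2) ⟩
    s * (k C 2) + k * (k * s + x)
      ≡⟨ cong₂ (λ m n → m + k * n) (sym (∑-allFin-const s (k C 2))) (sym (trans (∑-count L) len)) ⟩
    ∑ (λ _ → k C 2) (allFin s) + k * ∑ (λ d → count d L) (allFin s)
      ≡⟨ cong (∑ (λ _ → k C 2) (allFin s) +_) (sym (∑-*ˡ k (λ d → count d L) (allFin s))) ⟩
    ∑ (λ _ → k C 2) (allFin s) + ∑ (λ d → k * count d L) (allFin s)
      ≡⟨ sym (∑-+ (λ _ → k C 2) (λ d → k * count d L) (allFin s)) ⟩
    ∑ (λ d → k C 2 + k * count d L) (allFin s)
      ≤⟨ ∑-mono (λ d → kC2+k*m≤mC2+k*k k (count d L)) (allFin s) ⟩
    ∑ (λ d → count d L C 2 + k * k) (allFin s)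
      ≡⟨ ∑-+ (λ d → count d L C 2) (λ _ → k * k) (allFin s) ⟩
    ∑ (λ d → count d L C 2) (allFin s) + ∑ (λ _ → k * k) (allFin s)
      ≡⟨ cong₂ _+_ (∑-count-C2 L) (∑-allFin-const s (k * k)) ⟩
    ∑-pairs (λ b c → 𝟙 (b ≟ c)) L + s * (k * k) ∎)
    where open ≤-Reasoning

module _ {q : ℕ} (F : FieldOn q) where
  open FieldOn F renaming (_+_ to _⊕_; _*_ to _⊗_)
  private
    module R = IsCommutativeRing isCommutativeRing

    commutativeRing : CommutativeRing 0ℓ 0ℓ
    commutativeRing = record { isCommutativeRing = isCommutativeRing }

  open RingProperties (CommutativeRing.ring commutativeRing) using (-‿distribˡ-*)
  open CommutativeSemigroupProperties (CommutativeRing.+-commutativeSemigroup commutativeRing)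
    using () renaming (interchange to ⊕-interchange)

  infixl 6 _−_
  _−_ : Fin q → Fin q → Fin q
  u − a = u ⊕ (- a)

  −-⊕-cancel : ∀ u a → (u − a) ⊕ a ≡ u
  −-⊕-cancel u a = trans (R.+-assoc u (- a) a) (trans (cong (u ⊕_) (R.-‿inverseˡ a)) (R.+-identityʳ u))

  onLine-through : ∀ A B a₁ a₂ u₁ u₂ → (A ⊗ (u₁ − a₁)) ⊕ (B ⊗ (u₂ − a₂)) ≡ 0# →
                   OnLine F A B ((A ⊗ a₁) ⊕ (B ⊗ a₂)) (u₁ , u₂)
  onLine-through A B a₁ a₂ u₁ u₂ A·[u−a]≡0 = begin
    (A ⊗ u₁) ⊕ (B ⊗ u₂)
      ≡⟨ cong₂ (λ x y → (A ⊗ x) ⊕ (B ⊗ y)) (sym (−-⊕-cancel u₁ a₁)) (sym (−-⊕-cancel u₂ a₂)) ⟩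
    (A ⊗ ((u₁ − a₁) ⊕ a₁)) ⊕ (B ⊗ ((u₂ − a₂) ⊕ a₂))
      ≡⟨ cong₂ _⊕_ (R.distribˡ A (u₁ − a₁) a₁) (R.distribˡ B (u₂ − a₂) a₂) ⟩
    ((A ⊗ (u₁ − a₁)) ⊕ (A ⊗ a₁)) ⊕ ((B ⊗ (u₂ − a₂)) ⊕ (B ⊗ a₂))
      ≡⟨ ⊕-interchange _ _ _ _ ⟩
    ((A ⊗ (u₁ − a₁)) ⊕ (B ⊗ (u₂ − a₂))) ⊕ ((A ⊗ a₁) ⊕ (B ⊗ a₂))
      ≡⟨ cong (_⊕ ((A ⊗ a₁) ⊕ (B ⊗ a₂))) A·[u−a]≡0 ⟩
    0# ⊕ ((A ⊗ a₁) ⊕ (B ⊗ a₂))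
      ≡⟨ R.+-identityˡ _ ⟩
    (A ⊗ a₁) ⊕ (B ⊗ a₂) ∎
    where open ≡-Reasoning

  vertical-normal : ∀ dx dy → dx ≡ 0# → (1# ⊗ dx) ⊕ (0# ⊗ dy) ≡ 0#
  vertical-normal dx dy dx≡0 = trans (cong₂ _⊕_ (R.*-identityˡ dx) (R.zeroˡ dy)) (trans (R.+-identityʳ dx) dx≡0)

  slope-normal : ∀ m dx dy → m ⊗ dx ≡ dy → ((- m) ⊗ dx) ⊕ (1# ⊗ dy) ≡ 0#
  slope-normal m dx dy m·dx≡dy =
    trans (cong₂ _⊕_ (trans (sym (-‿distribˡ-* m dx)) (cong -_ m·dx≡dy)) (R.*-identityˡ dy)) (R.-‿inverseˡ dy)

  -- The q + 1 directions of lines: zero is vertical, suc m is slope m.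
  -- A point has the vertical direction from itself.
  slope : Fin q → {dx : Fin q} → Dec (dx ≡ 0#) → Fin (suc q)
  slope dy (yes _)   = zero
  slope dy (no dx≢0) = suc (dy ⊗ proj₁ (inverse _ dx≢0))

  direction : Point F → Point F → Fin (suc q)
  direction (a₁ , a₂) (u₁ , u₂) = slope (u₂ − a₂) ((u₁ − a₁) ≟ 0#)

  slope-spec : ∀ dx dy (dx≢0 : ¬ dx ≡ 0#) → (dy ⊗ proj₁ (inverse dx dx≢0)) ⊗ dx ≡ dy
  slope-spec dx dy dx≢0 with inverse dx dx≢0
  ... | dx⁻¹ , dx·dx⁻¹≡1 = begin
    (dy ⊗ dx⁻¹) ⊗ dx ≡⟨ R.*-assoc dy dx⁻¹ dx ⟩
    dy ⊗ (dx⁻¹ ⊗ dx) ≡⟨ cong (dy ⊗_) (trans (R.*-comm dx⁻¹ dx) dx·dx⁻¹≡1) ⟩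
    dy ⊗ 1#          ≡⟨ R.*-identityʳ dy ⟩
    dy               ∎
    where open ≡-Reasoning

  same-slope⇒collinear : ∀ a₁ a₂ u₁ u₂ v₁ v₂ (du : Dec (u₁ − a₁ ≡ 0#)) (dv : Dec (v₁ − a₁ ≡ 0#)) →
                         slope (u₂ − a₂) du ≡ slope (v₂ − a₂) dv → Collinear F (a₁ , a₂) (u₁ , u₂) (v₁ , v₂)
  same-slope⇒collinear a₁ a₂ u₁ u₂ v₁ v₂ (yes u-vertical) (yes v-vertical) _ =
    1# , 0# , _ , (λ (1≡0 , _) → 0≢1 (sym 1≡0)) , refl ,
    onLine-through 1# 0# a₁ a₂ u₁ u₂ (vertical-normal _ _ u-vertical) ,
    onLine-through 1# 0# a₁ a₂ v₁ v₂ (vertical-normal _ _ v-vertical)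
  same-slope⇒collinear a₁ a₂ u₁ u₂ v₁ v₂ (no du≢0) (no dv≢0) same-slope =
    - m , 1# , _ , (λ (_ , 1≡0) → 0≢1 (sym 1≡0)) , refl ,
    onLine-through (- m) 1# a₁ a₂ u₁ u₂ (slope-normal m _ _ (slope-spec _ _ du≢0)) ,
    onLine-through (- m) 1# a₁ a₂ v₁ v₂
      (slope-normal m _ _ (subst (λ m′ → m′ ⊗ (v₁ − a₁) ≡ v₂ − a₂) (sym (Data.Fin.Properties.suc-injective same-slope))
                                 (slope-spec _ _ dv≢0)))
    where m = (u₂ − a₂) ⊗ proj₁ (inverse _ du≢0)

  same-direction⇒collinear : ∀ a u v → direction a u ≡ direction a v → Collinear F a u v
  same-direction⇒collinear (a₁ , a₂) (u₁ , u₂) (v₁ , v₂) = same-slope⇒collinear a₁ a₂ u₁ u₂ v₁ v₂ _ _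

  collinear-swap₁₂ : ∀ {u v w} → Collinear F u v w → Collinear F v u w
  collinear-swap₁₂ (A , B , c , A,B≢0 , u∈ℓ , v∈ℓ , w∈ℓ) = A , B , c , A,B≢0 , v∈ℓ , u∈ℓ , w∈ℓ

  collinear-swap₂₃ : ∀ {u v w} → Collinear F u v w → Collinear F u w v
  collinear-swap₂₃ (A , B , c , A,B≢0 , u∈ℓ , v∈ℓ , w∈ℓ) = A , B , c , A,B≢0 , u∈ℓ , w∈ℓ , v∈ℓ

  𝟙-collinear : Point F → Point F → Point F → ℕ
  𝟙-collinear u v w = 𝟙 (collinear? F u v w)

  T≡∑-triples : ∀ P → T F P ≡ ∑-triples 𝟙-collinear P
  T≡∑-triples P = trans (length-filter _ (triples P)) (∑-triples-triples _ P)

  ∑-select-collinear : ∀ P → ∑-select (λ a r → ∑-pairs (𝟙-collinear a) r) P ≡ 3 * T F P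
  ∑-select-collinear P = begin
    ∑-select (λ a r → ∑-pairs (𝟙-collinear a) r) P ≡⟨ ∑-select-∑-pairs 𝟙-collinear swap₁₂ swap₂₃ P ⟩
    3 * ∑-triples 𝟙-collinear P                     ≡⟨ cong (3 *_) (T≡∑-triples P) ⟨
    3 * T F P                                       ∎
    where
    open ≡-Reasoning
    swap₁₂ : ∀ u v w → 𝟙-collinear u v w ≡ 𝟙-collinear v u w
    swap₁₂ u v w = 𝟙-cong collinear-swap₁₂ collinear-swap₁₂ (collinear? F u v w) (collinear? F v u w)
    swap₂₃ : ∀ u v w → 𝟙-collinear u v w ≡ 𝟙-collinear u w v
    swap₂₃ u v w = 𝟙-cong collinear-swap₂₃ collinear-swap₂₃ (collinear? F u v w) (collinear? F u w v)

  collinearPairs-≥ : ∀ k x a (r : List (Point F)) → length r ≡ k * suc q + x →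
                     (k C 2) * suc q + k * x ≤ ∑-pairs (𝟙-collinear a) r
  collinearPairs-≥ k x a r len = begin
    (k C 2) * suc q + k * x
      ≤⟨ equalPairs-≥ k x (map (direction a) r) (trans (length-map (direction a) r) len) ⟩
    ∑-pairs (λ d e → 𝟙 (d ≟ e)) (map (direction a) r)
      ≡⟨ ∑-pairs-map (λ d e → 𝟙 (d ≟ e)) (direction a) r ⟩
    ∑-pairs (λ u v → 𝟙 (direction a u ≟ direction a v)) r
      ≤⟨ ∑-pairs-mono (λ u v → 𝟙-mono (same-direction⇒collinear a u v)
                                              (direction a u ≟ direction a v) (collinear? F a u v)) r ⟩
    ∑-pairs (𝟙-collinear a) r ∎
    where open ≤-Reasoning

lemma1 : (q : ℕ) → IsPrimePower q → (F : FieldOn q) → (k x : ℕ) → x ≤ q + 1 →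
         (P : List (Point F)) → Unique P → length P ≡ k * (q + 1) + x + 1 →
         ((k C 2) * (q + 1) + k * x) * length P ≤ 3 * T F P
lemma1 q _ F k x _ P _ len = begin
  ((k C 2) * (q + 1) + k * x) * length P
    ≡⟨ cong (λ n → ((k C 2) * n + k * x) * length P) (+-comm q 1) ⟩
  ((k C 2) * suc q + k * x) * length P
    ≡⟨ *-comm _ (length P) ⟩
  length P * ((k C 2) * suc q + k * x)
    ≤⟨ ∑-select-≥ _ _ P (λ a r 1+|r|≡|P| → collinearPairs-≥ F k x a r (rest-length r 1+|r|≡|P|)) ⟩
  ∑-select (λ a r → ∑-pairs (𝟙-collinear F a) r) P
    ≡⟨ ∑-select-collinear F P ⟩
  3 * T F P ∎
  where
  open ≤-Reasoning
  rest-length : ∀ (r : List (Point F)) → suc (length r) ≡ length P → length r ≡ k * suc q + x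
  rest-length r 1+|r|≡|P| = suc-injective
    (trans 1+|r|≡|P| (trans len (trans (+-comm _ 1) (cong (λ n → suc (k * n + x)) (+-comm q 1)))))
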